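{- Let $G$ be a thick spider with spider partition $(S,K,R)$ where $|S|=|K|\ge3$, and let $e$ be a non-edge of $G$ joining a vertex $s\in S$ and a vertex of $R$. Let $\mu$ be the number of fill edges in an optimal solution of the ($P_4$-sparse,$+1$)-MinEdgeAddition Problem for the (disconnected) induced subgraph $G[\{s\}\cup R]$ and the non-edge $e$. Then the ($P_4$-sparse,$+1$)-MinEdgeAddition Problem for $G$ and $e$ admits an optimal solution with exactly $1+\mu$ fill edges (including $e$).
   Context: All graphs are finite, simple, undirected. A graph is $P_4$-sparse if no five vertices induce more than one $P_4$. A thick spider is a graph whose vertex set has a partition $(S,K,R)$ with $S$ independent, $K$ a clique, $|S|=|K|$, every vertex of $R$ adjacent to all of $K$ and none of $S$, and a bijection $f:S\to K$ with $N(s)\cap K=K\setminus\{f(s)\}$ for every $s\in S$. ($P_4$-sparse,$+1$)-MinEdgeAddition Problem: for a $P_4$-sparse graph $G$ and a non-edge $e$, a solution is a $P_4$-sparse graph $H$ with $V(H)=V(G)$ and $E(G)\cup\{e\}\subseteq E(H)$; fill edges are the edges of $E(H)\setminus E(G)$ (including $e$); an optimal solution minimizes their number. -}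

module Defs where

open import Data.Nat using (ℕ; zero; suc; _+_; _≤_)
open import Data.Bool using (Bool; true; false; _∧_; not)
open import Data.Fin using (Fin; toℕ; punchIn)
open import Data.Fin.Properties using () renaming (_≟_ to _≟ᶠ_)
open import Data.Nat.Properties using (_<?_)
open import Data.List using (List; map)
open import Data.Nat.ListAction using (sum)
open import Data.List using () renaming (allFin to allFinL)
open import Data.Product using (Σ; ∃; ∃-syntax; _×_; _,_)
open import Data.Sum using (_⊎_)
open import Relation.Nullary using (¬_; yes; no)
open import Relation.Binary.PropositionalEquality using (_≡_; _≢_; sym; trans)
open import Function using (_∘_)
open import Function.Definitions using (Injective)

record Graph (n : ℕ) : Set where
  field
    adj    : Fin n → Fin n → Bool
    symm   : ∀ i j → adj i j ≡ adj j i
    irrefl : ∀ i → adj i i ≡ false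
open Graph public

Edge : ∀ {n} → Graph n → Fin n → Fin n → Set
Edge G i j = adj G i j ≡ true

NonEdge : ∀ {n} → Graph n → Fin n → Fin n → Set
NonEdge G i j = adj G i j ≡ false

InducedPathP4 : ∀ {n} → Graph n → Fin n → Fin n → Fin n → Fin n → Set
InducedPathP4 G a b c d =
  (a ≢ b × a ≢ c × a ≢ d × b ≢ c × b ≢ d × c ≢ d) ×
  (Edge G a b × Edge G b c × Edge G c d) ×
  (NonEdge G a c × NonEdge G a d × NonEdge G b d)

InducesP4 : ∀ {n} → Graph n → (Fin 4 → Fin n) → Set
InducesP4 G w = ∃[ a ] ∃[ b ] ∃[ c ] ∃[ d ] InducedPathP4 G (w a) (w b) (w c) (w d)

-- P4-sparse: no five (distinct) vertices induce more than one P4.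
-- The 4-subsets of a 5-set {v 0,…,v 4} are exactly the sets v ∘ punchIn i
-- (omit v i), so "more than one P4" means two different omitted indices.
P4Sparse : ∀ {n} → Graph n → Set
P4Sparse {n} G = ∀ (v : Fin 5 → Fin n) → Injective _≡_ _≡_ v →
  ∀ (i j : Fin 5) → InducesP4 G (v ∘ punchIn i) → InducesP4 G (v ∘ punchIn j) → i ≡ j

fillIndicator : ∀ {n} → Graph n → Graph n → Fin n → Fin n → ℕ
fillIndicator G H i j with toℕ i <? toℕ j
... | no _ = 0
... | yes _ with adj H i j ∧ not (adj G i j)
...   | true = 1
...   | false = 0

fillCount : ∀ {n} → Graph n → Graph n → ℕ
fillCount {n} G H = sum (map (λ i → sum (map (fillIndicator G H i) (allFinL n))) (allFinL n))

IsSolution : ∀ {n} → Graph n → Fin n → Fin n → Graph n → Set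
IsSolution G u v H = P4Sparse H × (∀ i j → Edge G i j → Edge H i j) × Edge H u v

IsOptimalSolution : ∀ {n} → Graph n → Fin n → Fin n → Graph n → Set
IsOptimalSolution {n} G u v H =
  IsSolution G u v H × (∀ (H' : Graph n) → IsSolution G u v H' → fillCount G H ≤ fillCount G H')

induced : ∀ {n m} → Graph n → (Fin m → Fin n) → Graph m
induced G ι = record
  { adj = λ i j → adj G (ι i) (ι j)
  ; symm = λ i j → symm G (ι i) (ι j)
  ; irrefl = λ i → irrefl G (ι i) }

-- A thick spider partition (S,K,R) of G.  S = {sv i}, K = {kv i} (i : Fin k),
-- the bijection f : S → K is f (sv i) = kv i, and R is the set of remaining vertices.
record ThickSpider {n : ℕ} (G : Graph n) : Set where
  field
    k     : ℕ
    sv    : Fin k → Fin n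
    kv    : Fin k → Fin n
    sv-inj : Injective _≡_ _≡_ sv
    kv-inj : Injective _≡_ _≡_ kv
    disjointSK : ∀ i j → sv i ≢ kv j
  InS : Fin n → Set
  InS x = ∃[ i ] sv i ≡ x
  InK : Fin n → Set
  InK x = ∃[ i ] kv i ≡ x
  InR : Fin n → Set
  InR x = ¬ InS x × ¬ InK x
  field
    S-independent : ∀ i j → NonEdge G (sv i) (sv j)
    K-clique      : ∀ i j → i ≢ j → Edge G (kv i) (kv j)
    R-K-complete  : ∀ x → InR x → ∀ i → Edge G x (kv i)
    R-S-none      : ∀ x → InR x → ∀ i → NonEdge G x (sv i)
    S-K-thick     : ∀ i j → (Edge G (sv i) (kv j) → i ≢ j) × (i ≢ j → Edge G (sv i) (kv j))

-- Let u = f(s) be the partner of s in K.  An optimal solution H′ on {s} ∪ R is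
-- completed to G by keeping G everywhere else and adding the single edge su.
-- In G the vertex u is adjacent to everything except s, so it becomes universal,
-- and then every induced P4 either lies inside {s} ∪ R or is a spider path
-- s_p k_q k_p s_q; two P4s on five vertices are ruled out by the sparseness of H′
-- and by the partner structure of the spider.  Conversely, a solution restricted
-- to {s} ∪ R is a solution there, so it has at least μ fill edges inside, and it
-- needs at least one more: with two further legs s₁, s₂ (|S| ≥ 3), if none of
-- us, s₁s₂, s₁r, s₂r, s₁s, s₂s were added, s₁ u r s and s₂ u r s would be two P4s
-- on five vertices.

module Submission where

open import Defs
open import Data.Nat using (ℕ; zero; suc; _+_; _*_; _≤_; _<_; z≤n; s≤s)
open import Data.Nat.Properties
  using (_<?_; <-cmp; ≤-reflexive; ≤-refl; ≤-trans; +-identityʳ; +-mono-≤; *-identityˡ; *-identityʳ;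
         *-zeroʳ; *-suc; *-cancelˡ-≡; *-cancelˡ-≤; 1+n≰n; +-*-semiring; module ≤-Reasoning)
open import Algebra.Properties.Semiring.Sum +-*-semiring
  using (sum-syntax; sum-remove; sum-cong-≗; sum-replicate-zero; ∑-distrib-+; ∑-comm; *-distribˡ-sum; *-distribʳ-sum)
import Data.Nat.ListAction as List
open import Data.Bool using (Bool; true; false; _∧_; _∨_; not)
open import Data.Bool.Properties using (∧-inverseʳ; ∧-comm; ∨-comm; ∨-zeroʳ; ∨-identityʳ; ¬-not)
open import Data.Fin using (Fin; toℕ; punchIn; punchOut)
import Data.Fin as Fin
open import Data.Fin.Patterns using (0F; 1F; 2F; 3F)
open import Data.Fin.Properties using (_≟_; any?; toℕ-injective; injective⇒≤; punchIn-punchOut; punchInᵢ≢i)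
open import Data.List using (map; allFin; tabulate)
open import Data.List.Properties using (map-tabulate)
open import Data.Vec using (_∷_; []; lookup)
open import Data.Vec.Relation.Unary.All using (_∷_; [])
open import Data.Vec.Relation.Unary.AllPairs using (_∷_; [])
open import Data.Vec.Relation.Unary.Unique.Propositional using (Unique)
open import Data.Vec.Relation.Unary.Unique.Propositional.Properties using (lookup-injective)
open import Data.Product using (∃-syntax; _×_; _,_; proj₁; proj₂)
open import Data.Sum using (_⊎_; inj₁; inj₂)
open import Data.Empty using (⊥-elim)
open import Relation.Nullary using (Dec; yes; no; does; ¬_; contradiction)
open import Relation.Nullary.Decidable using (dec-true; dec-false; does-⇔; _×-dec_)
open import Relation.Binary using (tri<; tri≈; tri>)
open import Relation.Binary.PropositionalEquality
open import Function using (_∘_; id)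
open import Function.Definitions using (Injective)
open import Function.Bundles using (_⇔_; Equivalence; mk⇔)

-- Finite sums

𝟙 : Bool → ℕ
𝟙 true  = 1
𝟙 false = 0

𝟙[_] : ∀ {p} {P : Set p} → Dec P → ℕ
𝟙[ P? ] = 𝟙 (does P?)

∑-mono-≤ : ∀ {n} {f g : Fin n → ℕ} → (∀ x → f x ≤ g x) → ∑[ x < n ] f x ≤ ∑[ x < n ] g x
∑-mono-≤ {zero}  f≤g = z≤n
∑-mono-≤ {suc n} f≤g = +-mono-≤ (f≤g _) (∑-mono-≤ (f≤g ∘ Fin.suc))

∑-select : ∀ {n} (a : Fin n) (f : Fin n → ℕ) → ∑[ x < n ] (𝟙[ x ≟ a ] * f x) ≡ f a
∑-select {suc n} a f = begin
  ∑[ x < suc n ] (𝟙[ x ≟ a ] * f x)                        ≡⟨ sum-remove {i = a} (λ x → 𝟙[ x ≟ a ] * f x) ⟩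
  𝟙[ a ≟ a ] * f a + ∑[ x < n ] (𝟙[ punchIn a x ≟ a ] * f (punchIn a x))
    ≡⟨ cong₂ _+_ (cong (λ b → 𝟙 b * f a) (dec-true (a ≟ a) refl))
                 (trans (sum-cong-≗ λ x → cong (λ b → 𝟙 b * f (punchIn a x)) (dec-false (punchIn a x ≟ a) (punchInᵢ≢i a x)))
                        (sum-replicate-zero n)) ⟩
  f a + 0 + 0                                               ≡⟨ trans (+-identityʳ _) (+-identityʳ _) ⟩
  f a                                                       ∎
  where open ≡-Reasoning

∑-𝟙[≟] : ∀ {n} (a : Fin n) → ∑[ x < n ] 𝟙[ x ≟ a ] ≡ 1
∑-𝟙[≟] a = trans (sum-cong-≗ λ x → sym (*-identityʳ 𝟙[ x ≟ a ])) (∑-select a (λ _ → 1))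

∑∑-𝟙[≟,≟] : ∀ {n} (a b : Fin n) → ∑[ x < n ] ∑[ y < n ] 𝟙[ x ≟ a ×-dec y ≟ b ] ≡ 1
∑∑-𝟙[≟,≟] {n} a b = trans (sum-cong-≗ row) (∑-𝟙[≟] a)
  where
  row : ∀ x → ∑[ y < n ] 𝟙[ x ≟ a ×-dec y ≟ b ] ≡ 𝟙[ x ≟ a ]
  row x with x ≟ a
  ... | yes _ = ∑-𝟙[≟] b
  ... | no  _ = sum-replicate-zero n

InImage : ∀ {m n} → (Fin m → Fin n) → Fin n → Set
InImage ι x = ∃[ j ] ι j ≡ x

image? : ∀ {m n} (ι : Fin m → Fin n) x → Dec (InImage ι x)
image? ι x = any? (λ j → ι j ≟ x)

module _ {m n} {ι : Fin m → Fin n} (ι-inj : Injective _≡_ _≡_ ι) where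

  ∑-preimages : ∀ x → ∑[ j < m ] 𝟙[ x ≟ ι j ] ≡ 𝟙[ image? ι x ]
  ∑-preimages x with image? ι x
  ... | yes (j₀ , refl) = trans (sum-cong-≗ λ j → cong 𝟙 (does-⇔ (mk⇔ (sym ∘ ι-inj) (cong ι ∘ sym)) (ι j₀ ≟ ι j) (j ≟ j₀)))
                                (∑-𝟙[≟] j₀)
  ... | no  x∉ι = trans (sum-cong-≗ λ j → cong 𝟙 (dec-false (x ≟ ι j) (λ e → x∉ι (j , sym e))))
                        (sum-replicate-zero m)

  ∑-reindex : ∀ (f : Fin n → ℕ) → ∑[ j < m ] f (ι j) ≡ ∑[ x < n ] (𝟙[ image? ι x ] * f x)
  ∑-reindex f = begin
    ∑[ j < m ] f (ι j)                            ≡⟨ sum-cong-≗ (λ j → ∑-select (ι j) f) ⟨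
    ∑[ j < m ] ∑[ x < n ] (𝟙[ x ≟ ι j ] * f x)    ≡⟨ ∑-comm (λ j x → 𝟙[ x ≟ ι j ] * f x) ⟩
    ∑[ x < n ] ∑[ j < m ] (𝟙[ x ≟ ι j ] * f x)    ≡⟨ sum-cong-≗ (λ x → *-distribʳ-sum (f x) (λ j → 𝟙[ x ≟ ι j ])) ⟨
    ∑[ x < n ] (∑[ j < m ] 𝟙[ x ≟ ι j ] * f x)    ≡⟨ sum-cong-≗ (λ x → cong (_* f x) (∑-preimages x)) ⟩
    ∑[ x < n ] (𝟙[ image? ι x ] * f x)            ∎
    where open ≡-Reasoning

  ∑∑-reindex : ∀ (F : Fin n → Fin n → ℕ) →
    ∑[ i < m ] ∑[ j < m ] F (ι i) (ι j) ≡ ∑[ x < n ] ∑[ y < n ] (𝟙[ image? ι x ] * (𝟙[ image? ι y ] * F x y))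
  ∑∑-reindex F = begin
    ∑[ i < m ] ∑[ j < m ] F (ι i) (ι j)                        ≡⟨ sum-cong-≗ (λ i → ∑-reindex (F (ι i))) ⟩
    ∑[ i < m ] ∑[ y < n ] (𝟙[ image? ι y ] * F (ι i) y)        ≡⟨ ∑-reindex (λ x → ∑[ y < n ] (𝟙[ image? ι y ] * F x y)) ⟩
    ∑[ x < n ] (𝟙[ image? ι x ] * ∑[ y < n ] (𝟙[ image? ι y ] * F x y))
      ≡⟨ sum-cong-≗ (λ x → *-distribˡ-sum 𝟙[ image? ι x ] (λ y → 𝟙[ image? ι y ] * F x y)) ⟩
    ∑[ x < n ] ∑[ y < n ] (𝟙[ image? ι x ] * (𝟙[ image? ι y ] * F x y)) ∎
    where open ≡-Reasoning

sum-map-allFin : ∀ {n} (f : Fin n → ℕ) → List.sum (map f (allFin n)) ≡ ∑[ x < n ] f x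
sum-map-allFin {n} f = trans (cong List.sum (map-tabulate id f)) (sum-tabulate n f)
  where
  sum-tabulate : ∀ n (f : Fin n → ℕ) → List.sum (tabulate f) ≡ ∑[ x < n ] f x
  sum-tabulate zero    f = refl
  sum-tabulate (suc n) f = cong (f Fin.zero +_) (sum-tabulate n (f ∘ Fin.suc))

∑∑-symmetric : ∀ {n} (h : Fin n → Fin n → ℕ) → (∀ x y → h x y ≡ h y x) → (∀ x → h x x ≡ 0) →
  ∑[ x < n ] ∑[ y < n ] h x y ≡ 2 * ∑[ x < n ] ∑[ y < n ] (𝟙[ toℕ x <? toℕ y ] * h x y)
∑∑-symmetric {n} h h-sym h-diag = begin
  ∑[ x < n ] ∑[ y < n ] h x y                                 ≡⟨ sum-cong-≗ (λ x → sum-cong-≗ (split x)) ⟩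
  ∑[ x < n ] ∑[ y < n ] (below x y + below y x)               ≡⟨ sum-cong-≗ (λ x → ∑-distrib-+ (below x) (λ y → below y x)) ⟩
  ∑[ x < n ] (∑[ y < n ] below x y + ∑[ y < n ] below y x)    ≡⟨ ∑-distrib-+ (λ x → ∑[ y < n ] below x y) (λ x → ∑[ y < n ] below y x) ⟩
  B + ∑[ x < n ] ∑[ y < n ] below y x                         ≡⟨ cong (B +_) (∑-comm (λ x y → below y x)) ⟩
  B + B                                                       ≡⟨ cong (B +_) (+-identityʳ B) ⟨
  2 * B                                                       ∎
  where
  open ≡-Reasoning
  below : Fin n → Fin n → ℕ
  below x y = 𝟙[ toℕ x <? toℕ y ] * h x y
  B : ℕ
  B = ∑[ x < n ] ∑[ y < n ] below x y
  split : ∀ x y → h x y ≡ below x y + below y x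
  split x y with <-cmp (toℕ x) (toℕ y)
  ... | tri< x<y _ y≮x rewrite dec-true (toℕ x <? toℕ y) x<y | dec-false (toℕ y <? toℕ x) y≮x =
    sym (trans (+-identityʳ _) (+-identityʳ _))
  ... | tri> x≮y _ y<x rewrite dec-false (toℕ x <? toℕ y) x≮y | dec-true (toℕ y <? toℕ x) y<x =
    trans (h-sym x y) (sym (+-identityʳ _))
  ... | tri≈ x≮y x≡y y≮x rewrite dec-false (toℕ x <? toℕ y) x≮y | dec-false (toℕ y <? toℕ x) y≮x
                             | toℕ-injective x≡y = h-diag y

∑∑-distrib-+ : ∀ {n} (F F′ : Fin n → Fin n → ℕ) →
  ∑[ x < n ] ∑[ y < n ] (F x y + F′ x y) ≡ ∑[ x < n ] ∑[ y < n ] F x y + ∑[ x < n ] ∑[ y < n ] F′ x y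
∑∑-distrib-+ {n} F F′ = trans (sum-cong-≗ (λ x → ∑-distrib-+ (F x) (F′ x)))
                              (∑-distrib-+ (λ x → ∑[ y < n ] F x y) (λ x → ∑[ y < n ] F′ x y))

∑∑-mono-≤ : ∀ {n} {F F′ : Fin n → Fin n → ℕ} → (∀ x y → F x y ≤ F′ x y) →
  ∑[ x < n ] ∑[ y < n ] F x y ≤ ∑[ x < n ] ∑[ y < n ] F′ x y
∑∑-mono-≤ F≤F′ = ∑-mono-≤ (λ x → ∑-mono-≤ (F≤F′ x))

𝟙*-≤ : ∀ b n → 𝟙 b * n ≤ n
𝟙*-≤ true  n = ≤-reflexive (*-identityˡ n)
𝟙*-≤ false n = z≤n

-- Fill edges

-- Fill edges are counted as ordered pairs so that sums can be reindexed along
-- embeddings, which need not preserve the order of Fin.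
fill : ∀ {n} → Graph n → Graph n → Fin n → Fin n → ℕ
fill G H x y = 𝟙 (adj H x y ∧ not (adj G x y))

fillSum : ∀ {n} → Graph n → Graph n → ℕ
fillSum {n} G H = ∑[ x < n ] ∑[ y < n ] fill G H x y

fillSum≡2*fillCount : ∀ {n} (G H : Graph n) → fillSum G H ≡ 2 * fillCount G H
fillSum≡2*fillCount {n} G H = begin
  fillSum G H                                                       ≡⟨ ∑∑-symmetric (fill G H) fill-sym fill-diag ⟩
  2 * ∑[ x < n ] ∑[ y < n ] (𝟙[ toℕ x <? toℕ y ] * fill G H x y)    ≡⟨ cong (2 *_) fillCount-as-∑ ⟨
  2 * fillCount G H                                                 ∎
  where
  open ≡-Reasoning
  fill-sym : ∀ x y → fill G H x y ≡ fill G H y x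
  fill-sym x y = cong₂ (λ h g → 𝟙 (h ∧ not g)) (symm H x y) (symm G x y)
  fill-diag : ∀ x → fill G H x x ≡ 0
  fill-diag x = cong (λ h → 𝟙 (h ∧ not (adj G x x))) (irrefl H x)
  fillIndicator-as-𝟙 : ∀ i j → fillIndicator G H i j ≡ 𝟙[ toℕ i <? toℕ j ] * fill G H i j
  fillIndicator-as-𝟙 i j with toℕ i <? toℕ j
  ... | no  i≮j rewrite dec-false (toℕ i <? toℕ j) i≮j = refl
  ... | yes i<j rewrite dec-true (toℕ i <? toℕ j) i<j with adj H i j ∧ not (adj G i j)
  ...   | true  = refl
  ...   | false = refl
  fillCount-as-∑ : fillCount G H ≡ ∑[ x < n ] ∑[ y < n ] (𝟙[ toℕ x <? toℕ y ] * fill G H x y)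
  fillCount-as-∑ = trans (sum-map-allFin (λ i → List.sum (map (fillIndicator G H i) (allFin n))))
    (sum-cong-≗ λ i → trans (sum-map-allFin (fillIndicator G H i)) (sum-cong-≗ (fillIndicator-as-𝟙 i)))

-- Adding an edge, and overlaying a graph on the image of an embedding

addEdge : ∀ {n} (H : Graph n) (u v : Fin n) → u ≢ v → Graph n
addEdge H u v u≢v = record
  { adj    = λ x y → adj H x y ∨ does (x ≟ u ×-dec y ≟ v) ∨ does (x ≟ v ×-dec y ≟ u)
  ; symm   = λ x y → cong₂ _∨_ (symm H x y)
      (trans (cong₂ _∨_ (∧-comm (does (x ≟ u)) (does (y ≟ v))) (∧-comm (does (x ≟ v)) (does (y ≟ u))))
             (∨-comm (does (y ≟ v ×-dec x ≟ u)) (does (y ≟ u ×-dec x ≟ v))))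
  ; irrefl = λ x → cong₂ _∨_ (irrefl H x) (cong₂ _∨_
      (dec-false (x ≟ u ×-dec x ≟ v) (λ (x≡u , x≡v) → u≢v (trans (sym x≡u) x≡v)))
      (dec-false (x ≟ v ×-dec x ≟ u) (λ (x≡v , x≡u) → u≢v (trans (sym x≡u) x≡v))))
  }

module _ {n} (H : Graph n) {u v : Fin n} (u≢v : u ≢ v) where

  addEdge-⊇ : ∀ {x y} → Edge H x y → Edge (addEdge H u v u≢v) x y
  addEdge-⊇ e = cong (_∨ _) e

  addEdge-new : Edge (addEdge H u v u≢v) u v
  addEdge-new = trans (cong (λ b → adj H u v ∨ b ∨ does (u ≟ v ×-dec v ≟ u)) (dec-true (u ≟ u ×-dec v ≟ v) (refl , refl))) (∨-zeroʳ _)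

  addEdge-other : ∀ {x y} → ¬ (x ≡ u × y ≡ v) → ¬ (x ≡ v × y ≡ u) → adj (addEdge H u v u≢v) x y ≡ adj H x y
  addEdge-other {x} {y} ¬uv ¬vu =
    trans (cong₂ (λ b c → adj H x y ∨ b ∨ c) (dec-false (x ≟ u ×-dec y ≟ v) ¬uv) (dec-false (x ≟ v ×-dec y ≟ u) ¬vu))
          (∨-identityʳ _)

  fillSum-addEdge : ∀ (G : Graph n) → NonEdge H u v → NonEdge G u v →
    fillSum G (addEdge H u v u≢v) ≡ 2 + fillSum G H
  fillSum-addEdge G Huv Guv = begin
    fillSum G (addEdge H u v u≢v)                              ≡⟨ sum-cong-≗ (λ x → sum-cong-≗ (pointwise x)) ⟩
    ∑[ x < n ] ∑[ y < n ] (new x y + fill G H x y)             ≡⟨ ∑∑-distrib-+ new (fill G H) ⟩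
    ∑[ x < n ] ∑[ y < n ] new x y + fillSum G H
      ≡⟨ cong (_+ fillSum G H) (trans (∑∑-distrib-+ (λ x y → 𝟙[ x ≟ u ×-dec y ≟ v ]) (λ x y → 𝟙[ x ≟ v ×-dec y ≟ u ]))
                                      (cong₂ _+_ (∑∑-𝟙[≟,≟] u v) (∑∑-𝟙[≟,≟] v u))) ⟩
    2 + fillSum G H                                            ∎
    where
    open ≡-Reasoning
    new : Fin n → Fin n → ℕ
    new x y = 𝟙[ x ≟ u ×-dec y ≟ v ] + 𝟙[ x ≟ v ×-dec y ≟ u ]
    pointwise : ∀ x y → fill G (addEdge H u v u≢v) x y ≡ new x y + fill G H x y
    pointwise x y with x ≟ u ×-dec y ≟ v | x ≟ v ×-dec y ≟ u
    ... | yes (refl , refl) | yes (u≡v , _) = contradiction u≡v u≢v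
    ... | yes (refl , refl) | no ¬vu
      rewrite dec-true (u ≟ u ×-dec v ≟ v) (refl , refl) | dec-false (u ≟ v ×-dec v ≟ u) ¬vu | Huv | Guv = refl
    ... | no ¬uv | yes (refl , refl)
      rewrite dec-false (v ≟ u ×-dec u ≟ v) ¬uv | dec-true (v ≟ v ×-dec u ≟ u) (refl , refl)
            | symm H v u | Huv | symm G v u | Guv = refl
    ... | no ¬uv | no ¬vu rewrite dec-false (x ≟ u ×-dec y ≟ v) ¬uv | dec-false (x ≟ v ×-dec y ≟ u) ¬vu =
      cong (λ h → 𝟙 (h ∧ not (adj G x y))) (∨-identityʳ (adj H x y))

module _ {m n} (G : Graph n) (ι : Fin m → Fin n) (H′ : Graph m) where

  overlayAdj : ∀ {x y} → Dec (InImage ι x) → Dec (InImage ι y) → Bool → Bool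
  overlayAdj (yes (i , _)) (yes (j , _)) _ = adj H′ i j
  overlayAdj _             _             b = b

  overlay : Graph n
  overlay = record
    { adj    = λ x y → overlayAdj (image? ι x) (image? ι y) (adj G x y)
    ; symm   = λ x y → overlayAdj-sym (image? ι x) (image? ι y) (symm G x y)
    ; irrefl = λ x → overlayAdj-irrefl (image? ι x) (irrefl G x)
    }
    where
    overlayAdj-sym : ∀ {x y} (x? : Dec (InImage ι x)) (y? : Dec (InImage ι y)) {b b′} →
      b ≡ b′ → overlayAdj x? y? b ≡ overlayAdj y? x? b′
    overlayAdj-sym (yes (i , _)) (yes (j , _)) _ = symm H′ i j
    overlayAdj-sym (yes _)       (no _)        e = e
    overlayAdj-sym (no _)        (yes _)       e = e
    overlayAdj-sym (no _)        (no _)        e = e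
    overlayAdj-irrefl : ∀ {x} (x? : Dec (InImage ι x)) {b} → b ≡ false → overlayAdj x? x? b ≡ false
    overlayAdj-irrefl (yes (i , _)) _ = irrefl H′ i
    overlayAdj-irrefl (no _)        e = e

  overlay-image : Injective _≡_ _≡_ ι → ∀ i j → adj overlay (ι i) (ι j) ≡ adj H′ i j
  overlay-image ι-inj i j = on-image (image? ι (ι i)) (image? ι (ι j))
    where
    on-image : (x? : Dec (InImage ι (ι i))) (y? : Dec (InImage ι (ι j))) {b : Bool} → overlayAdj x? y? b ≡ adj H′ i j
    on-image (yes (i′ , ιi′≡ιi)) (yes (j′ , ιj′≡ιj)) = cong₂ (adj H′) (ι-inj ιi′≡ιi) (ι-inj ιj′≡ιj)
    on-image (no ιi∉ι)           _                    = contradiction (i , refl) ιi∉ι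
    on-image (yes _)             (no ιj∉ι)            = contradiction (j , refl) ιj∉ι

  overlay-outside : ∀ {x y} → ¬ InImage ι x ⊎ ¬ InImage ι y → adj overlay x y ≡ adj G x y
  overlay-outside {x} {y} = outside (image? ι x) (image? ι y)
    where
    outside : (x? : Dec (InImage ι x)) (y? : Dec (InImage ι y)) {b : Bool} →
      ¬ InImage ι x ⊎ ¬ InImage ι y → overlayAdj x? y? b ≡ b
    outside (yes x∈ι) (yes y∈ι) (inj₁ x∉ι) = contradiction x∈ι x∉ι
    outside (yes x∈ι) (yes y∈ι) (inj₂ y∉ι) = contradiction y∈ι y∉ι
    outside (yes _)   (no _)    _          = refl
    outside (no _)    _         _          = refl

  overlay-⊇ : (∀ i j → Edge (induced G ι) i j → Edge H′ i j) → ∀ {x y} → Edge G x y → Edge overlay x y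
  overlay-⊇ H′-⊇ {x} {y} = superset (image? ι x) (image? ι y)
    where
    superset : (x? : Dec (InImage ι x)) (y? : Dec (InImage ι y)) → Edge G x y → overlayAdj x? y? (adj G x y) ≡ true
    superset (yes (i , refl)) (yes (j , refl)) e = H′-⊇ i j e
    superset (yes _)          (no _)           e = e
    superset (no _)           _                e = e

  fillSum-overlay : Injective _≡_ _≡_ ι → fillSum G overlay ≡ fillSum (induced G ι) H′
  fillSum-overlay ι-inj = begin
    fillSum G overlay                                                          ≡⟨ sum-cong-≗ (λ x → sum-cong-≗ (restricted x)) ⟨
    ∑[ x < n ] ∑[ y < n ] (𝟙[ image? ι x ] * (𝟙[ image? ι y ] * fill G overlay x y)) ≡⟨ ∑∑-reindex ι-inj (fill G overlay) ⟨
    ∑[ i < m ] ∑[ j < m ] fill G overlay (ι i) (ι j)                           ≡⟨ sum-cong-≗ (λ i → sum-cong-≗ (on-image i)) ⟩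
    fillSum (induced G ι) H′                                                   ∎
    where
    open ≡-Reasoning
    on-image : ∀ i j → fill G overlay (ι i) (ι j) ≡ fill (induced G ι) H′ i j
    on-image i j = cong (λ h → 𝟙 (h ∧ not (adj G (ι i) (ι j)))) (overlay-image ι-inj i j)
    restricted : ∀ x y → 𝟙[ image? ι x ] * (𝟙[ image? ι y ] * fill G overlay x y) ≡ fill G overlay x y
    restricted x y with image? ι x | image? ι y
    ... | yes _ | yes _ = trans (*-identityˡ _) (*-identityˡ _)
    ... | yes _ | no _  = cong 𝟙 (sym (∧-inverseʳ (adj G x y)))
    ... | no _  | _     = cong 𝟙 (sym (∧-inverseʳ (adj G x y)))

2+fillSum-induced≤fillSum : ∀ {m n} {ι : Fin m → Fin n} → Injective _≡_ _≡_ ι → ∀ (G H : Graph n) {p q} →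
  ¬ InImage ι p → p ≢ q → Edge H p q → NonEdge G p q →
  2 + fillSum (induced G ι) (induced H ι) ≤ fillSum G H
2+fillSum-induced≤fillSum {m} {n} {ι} ι-inj G H {p} {q} p∉ι p≢q Hpq Gpq = begin
  2 + fillSum (induced G ι) (induced H ι)
    ≡⟨ cong₂ (λ a b → a + b + fillSum (induced G ι) (induced H ι)) (∑∑-𝟙[≟,≟] p q) (∑∑-𝟙[≟,≟] q p) ⟨
  ∑∑ (λ x y → 𝟙[ x ≟ p ×-dec y ≟ q ]) + ∑∑ (λ x y → 𝟙[ x ≟ q ×-dec y ≟ p ]) + fillSum (induced G ι) (induced H ι)
    ≡⟨ cong₂ _+_ (∑∑-distrib-+ (λ x y → 𝟙[ x ≟ p ×-dec y ≟ q ]) (λ x y → 𝟙[ x ≟ q ×-dec y ≟ p ])) (sym (∑∑-reindex ι-inj (fill G H))) ⟨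
  ∑∑ pair + ∑∑ inside                  ≡⟨ ∑∑-distrib-+ pair inside ⟨
  ∑∑ (λ x y → pair x y + inside x y)   ≤⟨ ∑∑-mono-≤ pointwise ⟩
  fillSum G H                          ∎
  where
  open ≤-Reasoning
  ∑∑ : (Fin n → Fin n → ℕ) → ℕ
  ∑∑ F = ∑[ x < n ] ∑[ y < n ] F x y
  pair inside : Fin n → Fin n → ℕ
  pair x y = 𝟙[ x ≟ p ×-dec y ≟ q ] + 𝟙[ x ≟ q ×-dec y ≟ p ]
  inside x y = 𝟙[ image? ι x ] * (𝟙[ image? ι y ] * fill G H x y)
  pointwise : ∀ x y → pair x y + inside x y ≤ fill G H x y
  pointwise x y with x ≟ p ×-dec y ≟ q | x ≟ q ×-dec y ≟ p
  ... | yes (refl , refl) | yes (p≡q , _) = contradiction p≡q p≢q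
  ... | yes (refl , refl) | no ¬qp
    rewrite dec-true (p ≟ p ×-dec q ≟ q) (refl , refl) | dec-false (p ≟ q ×-dec q ≟ p) ¬qp
          | dec-false (image? ι p) p∉ι | Hpq | Gpq = ≤-refl
  ... | no ¬pq | yes (refl , refl)
    rewrite dec-false (q ≟ p ×-dec p ≟ q) ¬pq | dec-true (q ≟ q ×-dec p ≟ p) (refl , refl)
          | dec-false (image? ι p) p∉ι | *-zeroʳ 𝟙[ image? ι q ]
          | symm H q p | Hpq | symm G q p | Gpq = ≤-refl
  ... | no ¬pq | no ¬qp rewrite dec-false (x ≟ p ×-dec y ≟ q) ¬pq | dec-false (x ≟ q ×-dec y ≟ p) ¬qp =
    ≤-trans (𝟙*-≤ (does (image? ι x)) _) (𝟙*-≤ (does (image? ι y)) _)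

-- Induced P4s

edge⇒¬nonEdge : ∀ {b : Bool} → b ≡ true → ¬ b ≡ false
edge⇒¬nonEdge refl ()

adj-swap : ∀ {n} (H : Graph n) {x y β} → adj H x y ≡ β → adj H y x ≡ β
adj-swap H {x} {y} = trans (symm H y x)

fresh-index : ∀ {k} → 3 ≤ k → (i j : Fin k) → ∃[ l ] l ≢ i × l ≢ j
fresh-index (s≤s (s≤s (s≤s _))) 0F                    0F                    = 1F , (λ ()) , (λ ())
fresh-index (s≤s (s≤s (s≤s _))) 0F                    1F                    = 2F , (λ ()) , (λ ())
fresh-index (s≤s (s≤s (s≤s _))) 0F                    (Fin.suc (Fin.suc _)) = 1F , (λ ()) , (λ ())
fresh-index (s≤s (s≤s (s≤s _))) 1F                    0F                    = 2F , (λ ()) , (λ ())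
fresh-index (s≤s (s≤s (s≤s _))) 1F                    1F                    = 0F , (λ ()) , (λ ())
fresh-index (s≤s (s≤s (s≤s _))) 1F                    (Fin.suc (Fin.suc _)) = 0F , (λ ()) , (λ ())
fresh-index (s≤s (s≤s (s≤s _))) (Fin.suc (Fin.suc _)) 0F                    = 1F , (λ ()) , (λ ())
fresh-index (s≤s (s≤s (s≤s _))) (Fin.suc (Fin.suc _)) (Fin.suc _)           = 0F , (λ ()) , (λ ())

Fin4-cover : ∀ {a b c d : Fin 4} → a ≢ b → a ≢ c → a ≢ d → b ≢ c → b ≢ d → c ≢ d →
  ∀ x → x ≡ a ⊎ x ≡ b ⊎ x ≡ c ⊎ x ≡ d
Fin4-cover {a} {b} {c} {d} a≢b a≢c a≢d b≢c b≢d c≢d x with x ≟ a | x ≟ b | x ≟ c | x ≟ d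
... | yes x≡a | _       | _       | _       = inj₁ x≡a
... | no _    | yes x≡b | _       | _       = inj₂ (inj₁ x≡b)
... | no _    | no _    | yes x≡c | _       = inj₂ (inj₂ (inj₁ x≡c))
... | no _    | no _    | no _    | yes x≡d = inj₂ (inj₂ (inj₂ x≡d))
... | no x≢a  | no x≢b  | no x≢c  | no x≢d  = contradiction (injective⇒≤ (λ {i} {j} → lookup-injective distinct i j)) 1+n≰n
  where
  distinct : Unique (a ∷ b ∷ c ∷ d ∷ x ∷ [])
  distinct = (a≢b ∷ a≢c ∷ a≢d ∷ (x≢a ∘ sym) ∷ []) ∷ (b≢c ∷ b≢d ∷ (x≢b ∘ sym) ∷ []) ∷ (c≢d ∷ (x≢c ∘ sym) ∷ []) ∷ ((x≢d ∘ sym) ∷ []) ∷ [] ∷ []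

InducedPathP4-covers : ∀ {n} {H : Graph n} {w : Fin 4 → Fin n} {a b c d} →
  InducedPathP4 H (w a) (w b) (w c) (w d) →
  (P : Fin n → Set) → P (w a) → P (w b) → P (w c) → P (w d) → ∀ x → P (w x)
InducedPathP4-covers {w = w} ((a≢b , a≢c , a≢d , b≢c , b≢d , c≢d) , _) P Pa Pb Pc Pd x
  with Fin4-cover (a≢b ∘ cong w) (a≢c ∘ cong w) (a≢d ∘ cong w) (b≢c ∘ cong w) (b≢d ∘ cong w) (c≢d ∘ cong w) x
... | inj₁ refl                 = Pa
... | inj₂ (inj₁ refl)          = Pb
... | inj₂ (inj₂ (inj₁ refl))   = Pc
... | inj₂ (inj₂ (inj₂ refl))   = Pd

InducesP4-transfer : ∀ {n₁ n₂} {A : Graph n₁} {B : Graph n₂} {w : Fin 4 → Fin n₁} {w′ : Fin 4 → Fin n₂} →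
  (∀ x y → adj B (w′ x) (w′ y) ≡ adj A (w x) (w y)) → (∀ {x y} → w′ x ≡ w′ y → w x ≡ w y) →
  InducesP4 A w → InducesP4 B w′
InducesP4-transfer {A = A} {B} {w} {w′} adj≡ reflect
  (a , b , c , d , (a≢b , a≢c , a≢d , b≢c , b≢d , c≢d) , (ab , bc , cd) , (ac , ad , bd)) =
  a , b , c , d , (≢′ a≢b , ≢′ a≢c , ≢′ a≢d , ≢′ b≢c , ≢′ b≢d , ≢′ c≢d) ,
  (adj′ ab , adj′ bc , adj′ cd) , (adj′ ac , adj′ ad , adj′ bd)
  where
  ≢′ : ∀ {x y} → w x ≢ w y → w′ x ≢ w′ y
  ≢′ wx≢wy = wx≢wy ∘ reflect
  adj′ : ∀ {x y β} → adj A (w x) (w y) ≡ β → adj B (w′ x) (w′ y) ≡ β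
  adj′ {x} {y} e = trans (adj≡ x y) e

P4Sparse-induced : ∀ {m n} {H : Graph n} {ι : Fin m → Fin n} → Injective _≡_ _≡_ ι →
  P4Sparse H → P4Sparse (induced H ι)
P4Sparse-induced {H = H} {ι} ι-inj sparse v v-inj i j P₁ P₂ = sparse (ι ∘ v) (v-inj ∘ ι-inj) i j (lift P₁) (lift P₂)
  where
  lift : ∀ {w} → InducesP4 (induced H ι) w → InducesP4 H (ι ∘ w)
  lift = InducesP4-transfer {A = induced H ι} {B = H} (λ _ _ → refl) ι-inj

IsSolution-induced : ∀ {m n} {G H : Graph n} {ι : Fin m → Fin n} → Injective _≡_ _≡_ ι →
  ∀ {j₁ j₂ x₁ x₂} → ι j₁ ≡ x₁ → ι j₂ ≡ x₂ → IsSolution G x₁ x₂ H → IsSolution (induced G ι) j₁ j₂ (induced H ι)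
IsSolution-induced {H = H} ι-inj refl refl (sparse , G⊆H , e) = P4Sparse-induced {H = H} ι-inj sparse , (λ i j → G⊆H _ _) , e

InducedPathP4-avoids : ∀ {n} {H : Graph n} {z a b c d} → (∀ y → y ≢ z → Edge H z y) →
  InducedPathP4 H a b c d → a ≢ z × b ≢ z × c ≢ z × d ≢ z
InducedPathP4-avoids {H = H} {z} {a} {b} {c} {d} z-universal ((_ , a≢c , _ , _ , b≢d , _) , _ , (ac , _ , bd)) =
  (λ { refl → edge⇒¬nonEdge (z-universal c (a≢c ∘ sym)) ac }) ,
  (λ { refl → edge⇒¬nonEdge (z-universal d (b≢d ∘ sym)) bd }) ,
  (λ { refl → edge⇒¬nonEdge (adj-swap H (z-universal a a≢c)) ac }) ,
  (λ { refl → edge⇒¬nonEdge (adj-swap H (z-universal b b≢d)) bd })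

-- Thick spiders

module _ {n} {G : Graph n} (T : ThickSpider G) where

  open ThickSpider T

  spider-parts : ∀ x → InS x ⊎ InK x ⊎ InR x
  spider-parts x with any? (λ a → sv a ≟ x) | any? (λ a → kv a ≟ x)
  ... | yes x∈S | _       = inj₁ x∈S
  ... | no _    | yes x∈K = inj₂ (inj₁ x∈K)
  ... | no x∉S  | no x∉K  = inj₂ (inj₂ (x∉S , x∉K))

  partner-nonadjacent : ∀ i → NonEdge G (sv i) (kv i)
  partner-nonadjacent i = ¬-not (λ e → proj₁ (S-K-thick i i) e refl)

  nonadjacent⇒partner : ∀ {a b} → NonEdge G (sv a) (kv b) → a ≡ b
  nonadjacent⇒partner {a} {b} ne with a ≟ b
  ... | yes a≡b = a≡b
  ... | no a≢b  = contradiction ne (edge⇒¬nonEdge (proj₂ (S-K-thick a b) a≢b))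

  partner-adjacent : ∀ i {y} → y ≢ kv i → y ≢ sv i → Edge G (kv i) y
  partner-adjacent i {y} y≢kᵢ y≢sᵢ with spider-parts y
  ... | inj₁ (a , refl)        = adj-swap G (proj₂ (S-K-thick a i) (y≢sᵢ ∘ cong sv))
  ... | inj₂ (inj₁ (a , refl)) = K-clique i a (y≢kᵢ ∘ cong kv ∘ sym)
  ... | inj₂ (inj₂ y∈R)        = adj-swap G (R-K-complete y y∈R i)

  -- {s_p, k_p, s_q, k_q}, the vertex set of the spider path s_p k_q k_p s_q.
  SpiderSet : Fin k → Fin k → Fin n → Set
  SpiderSet p q y = ∃[ t ] (t ≡ p ⊎ t ≡ q) × (sv t ≡ y ⊎ kv t ≡ y)

  SK-index-unique : ∀ {t t′ y} → sv t ≡ y ⊎ kv t ≡ y → sv t′ ≡ y ⊎ kv t′ ≡ y → t ≡ t′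
  SK-index-unique (inj₁ e) (inj₁ e′) = sv-inj (trans e (sym e′))
  SK-index-unique (inj₁ e) (inj₂ e′) = contradiction (trans e (sym e′)) (disjointSK _ _)
  SK-index-unique (inj₂ e) (inj₁ e′) = contradiction (trans e′ (sym e)) (disjointSK _ _)
  SK-index-unique (inj₂ e) (inj₂ e′) = kv-inj (trans e (sym e′))

  SpiderSet-partner : ∀ {p q y} → SpiderSet p q y →
    ∃[ y′ ] y′ ≢ y × SpiderSet p q y′ × (∀ {p′ q′} → SpiderSet p′ q′ y′ → SpiderSet p′ q′ y)
  SpiderSet-partner (t , t∈pq , inj₁ refl) =
    kv t , disjointSK t t ∘ sym , (t , t∈pq , inj₂ refl) ,
    λ { (t′ , t′∈pq′ , side′) → t′ , t′∈pq′ , inj₁ (cong sv (SK-index-unique side′ (inj₂ refl))) }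
  SpiderSet-partner (t , t∈pq , inj₂ refl) =
    sv t , disjointSK t t , (t , t∈pq , inj₁ refl) ,
    λ { (t′ , t′∈pq′ , side′) → t′ , t′∈pq′ , inj₂ (cong kv (SK-index-unique side′ (inj₁ refl))) }

-- Completing a solution on {s} ∪ R

module Completion {n} {G : Graph n} (T : ThickSpider G) (i₀ : Fin (ThickSpider.k T))
  {m} {ι : Fin m → Fin n} (ι-inj : Injective _≡_ _≡_ ι)
  (image-iff : ∀ x → InImage ι x ⇔ (x ≡ ThickSpider.sv T i₀ ⊎ ThickSpider.InR T x)) where

  open ThickSpider T

  s u : Fin n
  s = sv i₀
  u = kv i₀

  u≢s : u ≢ s
  u≢s = disjointSK i₀ i₀ ∘ sym

  S′ K′ : Fin n → Set
  S′ x = ∃[ a ] a ≢ i₀ × sv a ≡ x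
  K′ x = ∃[ a ] a ≢ i₀ × kv a ≡ x

  private
    image⇒ : ∀ {x} → InImage ι x → x ≡ s ⊎ InR x
    image⇒ {x} = Equivalence.to (image-iff x)

  S′∉ι : ∀ {x} → S′ x → ¬ InImage ι x
  S′∉ι (a , a≢i₀ , refl) x∈ι with image⇒ x∈ι
  ... | inj₁ sₐ≡s      = a≢i₀ (sv-inj sₐ≡s)
  ... | inj₂ (x∉S , _) = x∉S (a , refl)

  K∉ι : ∀ a → ¬ InImage ι (kv a)
  K∉ι a x∈ι with image⇒ x∈ι
  ... | inj₁ kₐ≡s      = disjointSK i₀ a (sym kₐ≡s)
  ... | inj₂ (_ , x∉K) = x∉K (a , refl)

  K′∉ι : ∀ {x} → K′ x → ¬ InImage ι x
  K′∉ι (a , _ , refl) = K∉ι a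

  ι≢u : ∀ {x} → InImage ι x → x ≢ u
  ι≢u x∈ι refl = K∉ι i₀ x∈ι

  S′≢u : ∀ {x} → S′ x → x ≢ u
  S′≢u (a , _ , refl) = disjointSK a i₀

  K′≢u : ∀ {x} → K′ x → x ≢ u
  K′≢u (a , a≢i₀ , refl) = a≢i₀ ∘ kv-inj

  data Part (x : Fin n) : Set where
    is-u  : x ≡ u → Part x
    in-S′ : S′ x → Part x
    in-K′ : K′ x → Part x
    in-ι  : InImage ι x → Part x

  part : ∀ x → Part x
  part x with spider-parts T x
  ... | inj₁ (a , sₐ≡x) with a ≟ i₀
  ...   | yes refl = in-ι (Equivalence.from (image-iff x) (inj₁ (sym sₐ≡x)))
  ...   | no a≢i₀  = in-S′ (a , a≢i₀ , sₐ≡x)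
  part x | inj₂ (inj₁ (a , kₐ≡x)) with a ≟ i₀
  ...   | yes refl = is-u (sym kₐ≡x)
  ...   | no a≢i₀  = in-K′ (a , a≢i₀ , kₐ≡x)
  part x | inj₂ (inj₂ x∈R) = in-ι (Equivalence.from (image-iff x) (inj₂ x∈R))

  G-S′-ι-nonadjacent : ∀ {x y} → S′ x → InImage ι y → NonEdge G x y
  G-S′-ι-nonadjacent (a , _ , refl) y∈ι with image⇒ y∈ι
  ... | inj₁ refl = S-independent a i₀
  ... | inj₂ y∈R  = adj-swap G (R-S-none _ y∈R a)

  G-K′-ι-adjacent : ∀ {x y} → K′ x → InImage ι y → Edge G x y
  G-K′-ι-adjacent (a , a≢i₀ , refl) y∈ι with image⇒ y∈ι
  ... | inj₁ refl = adj-swap G (proj₂ (S-K-thick i₀ a) (a≢i₀ ∘ sym))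
  ... | inj₂ y∈R  = adj-swap G (R-K-complete _ y∈R a)

  -- Adding su makes u universal: in G it is adjacent to every vertex except s.
  completion : Graph m → Graph n
  completion H′ = addEdge (overlay G ι H′) u s u≢s

  module _ (H′ : Graph m) where

    private
      H : Graph n
      H = completion H′

    completion-image : ∀ i j → adj H (ι i) (ι j) ≡ adj H′ i j
    completion-image i j =
      trans (addEdge-other (overlay G ι H′) u≢s (ι≢u (i , refl) ∘ proj₁) (ι≢u (j , refl) ∘ proj₂)) (overlay-image G ι H′ ι-inj i j)

    completion-outside : ∀ {x y} → ¬ InImage ι x → x ≢ u → y ≢ u → adj H x y ≡ adj G x y
    completion-outside x∉ι x≢u y≢u =
      trans (addEdge-other (overlay G ι H′) u≢s (x≢u ∘ proj₁) (y≢u ∘ proj₂)) (overlay-outside G ι H′ (inj₁ x∉ι))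

    completion-u : ∀ y → y ≢ u → Edge H u y
    completion-u y y≢u with s ≟ y
    ... | yes refl = addEdge-new (overlay G ι H′) u≢s
    ... | no s≢y   = trans (addEdge-other (overlay G ι H′) u≢s (s≢y ∘ sym ∘ proj₂) (u≢s ∘ proj₁))
                           (trans (overlay-outside G ι H′ (inj₁ (K∉ι i₀))) (partner-adjacent T i₀ y≢u (s≢y ∘ sym)))

    completion-⊇ : (∀ i j → Edge (induced G ι) i j → Edge H′ i j) → ∀ x y → Edge G x y → Edge H x y
    completion-⊇ H′-⊇ x y e = addEdge-⊇ (overlay G ι H′) u≢s (overlay-⊇ G ι H′ H′-⊇ e)

    fillSum-completion : fillSum G H ≡ 2 + fillSum (induced G ι) H′
    fillSum-completion =
      trans (fillSum-addEdge (overlay G ι H′) u≢s G (trans (overlay-outside G ι H′ (inj₁ (K∉ι i₀))) Gus) Gus)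
            (cong (2 +_) (fillSum-overlay G ι H′ ι-inj))
      where
      Gus : NonEdge G u s
      Gus = adj-swap G (partner-nonadjacent T i₀)

    fillCount-completion : fillCount G H ≡ suc (fillCount (induced G ι) H′)
    fillCount-completion = *-cancelˡ-≡ _ _ 2 (begin
      2 * fillCount G H                           ≡⟨ fillSum≡2*fillCount G H ⟨
      fillSum G H                                 ≡⟨ fillSum-completion ⟩
      2 + fillSum (induced G ι) H′                ≡⟨ cong (2 +_) (fillSum≡2*fillCount (induced G ι) H′) ⟩
      2 + 2 * fillCount (induced G ι) H′          ≡⟨ *-suc 2 _ ⟨
      2 * suc (fillCount (induced G ι) H′)        ∎)
      where open ≡-Reasoning

    S′-independent : ∀ {x y} → S′ x → S′ y → NonEdge H x y
    S′-independent x∈S′@(a , _ , refl) y∈S′@(b , _ , refl) =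
      trans (completion-outside (S′∉ι x∈S′) (S′≢u x∈S′) (S′≢u y∈S′)) (S-independent a b)

    S′-ι-nonadjacent : ∀ {x y} → S′ x → InImage ι y → NonEdge H x y
    S′-ι-nonadjacent x∈S′ y∈ι = trans (completion-outside (S′∉ι x∈S′) (S′≢u x∈S′) (ι≢u y∈ι)) (G-S′-ι-nonadjacent x∈S′ y∈ι)

    K′-clique : ∀ {x y} → K′ x → K′ y → x ≢ y → Edge H x y
    K′-clique x∈K′@(a , _ , refl) y∈K′@(b , _ , refl) x≢y =
      trans (completion-outside (K′∉ι x∈K′) (K′≢u x∈K′) (K′≢u y∈K′)) (K-clique a b (x≢y ∘ cong kv))

    K′-ι-adjacent : ∀ {x y} → K′ x → InImage ι y → Edge H x y
    K′-ι-adjacent x∈K′ y∈ι = trans (completion-outside (K′∉ι x∈K′) (K′≢u x∈K′) (ι≢u y∈ι)) (G-K′-ι-adjacent x∈K′ y∈ι)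

    S′-K′-nonadjacent⇒partner : ∀ {a b} → S′ (sv a) → K′ (kv b) → NonEdge H (sv a) (kv b) → a ≡ b
    S′-K′-nonadjacent⇒partner a∈S′ b∈K′ ne = nonadjacent⇒partner T (trans (sym (completion-outside (S′∉ι a∈S′) (S′≢u a∈S′) (K′≢u b∈K′))) ne)

    S′-neighbour : ∀ {x y} → S′ x → Edge H x y → y ≢ u → K′ y
    S′-neighbour {y = y} x∈S′ xy y≢u with part y
    ... | is-u y≡u   = contradiction y≡u y≢u
    ... | in-S′ y∈S′ = contradiction (S′-independent x∈S′ y∈S′) (edge⇒¬nonEdge xy)
    ... | in-K′ y∈K′ = y∈K′
    ... | in-ι y∈ι   = contradiction (S′-ι-nonadjacent x∈S′ y∈ι) (edge⇒¬nonEdge xy)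

    K′-non-neighbour : ∀ {x y} → K′ x → NonEdge H x y → x ≢ y → y ≢ u → S′ y
    K′-non-neighbour {y = y} x∈K′ xy x≢y y≢u with part y
    ... | is-u y≡u   = contradiction y≡u y≢u
    ... | in-S′ y∈S′ = y∈S′
    ... | in-K′ y∈K′ = contradiction xy (edge⇒¬nonEdge (K′-clique x∈K′ y∈K′ x≢y))
    ... | in-ι y∈ι   = contradiction xy (edge⇒¬nonEdge (K′-ι-adjacent x∈K′ y∈ι))

    ι-between : ∀ {a b c} → InImage ι b → InImage ι c → Edge H a b → NonEdge H a c → a ≢ u → InImage ι a
    ι-between {a} b∈ι c∈ι ab ac a≢u with part a
    ... | is-u a≡u   = contradiction a≡u a≢u
    ... | in-S′ a∈S′ = contradiction (S′-ι-nonadjacent a∈S′ b∈ι) (edge⇒¬nonEdge ab)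
    ... | in-K′ a∈K′ = contradiction ac (edge⇒¬nonEdge (K′-ι-adjacent a∈K′ c∈ι))
    ... | in-ι a∈ι   = a∈ι

    SpiderPath : Fin n → Fin n → Fin n → Fin n → Set
    SpiderPath a b c d = ∃[ p ] ∃[ q ] p ≢ i₀ × q ≢ i₀ × sv p ≡ a × kv q ≡ b × kv p ≡ c × sv q ≡ d

    SpiderPath-intro : ∀ {a b c d} → S′ a → K′ b → K′ c → S′ d → NonEdge H a c → NonEdge H b d → SpiderPath a b c d
    SpiderPath-intro a∈S′@(p , p≢i₀ , refl) b∈K′@(q , q≢i₀ , refl) c∈K′@(_ , _ , refl) d∈S′@(_ , _ , refl) ac bd =
      p , q , p≢i₀ , q≢i₀ , refl , refl ,
      cong kv (S′-K′-nonadjacent⇒partner a∈S′ c∈K′ ac) ,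
      cong sv (sym (S′-K′-nonadjacent⇒partner d∈S′ b∈K′ (adj-swap H bd)))

    P4-avoids-u : ∀ {a b c d} → InducedPathP4 H a b c d → a ≢ u × b ≢ u × c ≢ u × d ≢ u
    P4-avoids-u = InducedPathP4-avoids {H = H} completion-u

    P4-cases : ∀ {a b c d} → InducedPathP4 H a b c d →
      SpiderPath a b c d ⊎ (InImage ι a × InImage ι b × InImage ι c × InImage ι d)
    P4-cases {a} {b} {c} {d} path@((_ , a≢c , _ , _ , b≢d , _) , (ab , bc , cd) , (ac , _ , bd))
      with P4-avoids-u path | part b | part c
    ... | _ , b≢u , _ | is-u b≡u | _ = contradiction b≡u b≢u
    ... | a≢u , _ , c≢u , _ | in-S′ b∈S′ | _ =
      contradiction ac (edge⇒¬nonEdge (K′-clique (S′-neighbour b∈S′ (adj-swap H ab) a≢u) (S′-neighbour b∈S′ bc c≢u) a≢c))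
    ... | a≢u , _ , c≢u , d≢u | in-K′ b∈K′ | _ = inj₁ (SpiderPath-intro a∈S′ b∈K′ c∈K′ d∈S′ ac bd)
      where
      d∈S′ : S′ d
      d∈S′ = K′-non-neighbour b∈K′ bd b≢d d≢u
      c∈K′ : K′ c
      c∈K′ = S′-neighbour d∈S′ (adj-swap H cd) c≢u
      a∈S′ : S′ a
      a∈S′ = K′-non-neighbour c∈K′ (adj-swap H ac) (a≢c ∘ sym) a≢u
    ... | _ , _ , c≢u , _ | in-ι _ | is-u c≡u = contradiction c≡u c≢u
    ... | _ | in-ι b∈ι | in-S′ c∈S′ = contradiction (S′-ι-nonadjacent c∈S′ b∈ι) (edge⇒¬nonEdge (adj-swap H bc))
    ... | a≢u , _ | in-ι b∈ι | in-K′ c∈K′ =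
      contradiction (S′-ι-nonadjacent (K′-non-neighbour c∈K′ (adj-swap H ac) (a≢c ∘ sym) a≢u) b∈ι) (edge⇒¬nonEdge ab)
    ... | a≢u , _ , _ , d≢u | in-ι b∈ι | in-ι c∈ι =
      inj₂ (ι-between b∈ι c∈ι ab ac a≢u , b∈ι , c∈ι , ι-between c∈ι b∈ι (adj-swap H cd) (adj-swap H bd) d≢u)

    SpiderQuad : (Fin 4 → Fin n) → Set
    SpiderQuad w = ∃[ p ] ∃[ q ] p ≢ i₀ × q ≢ i₀ ×
      (∀ x → SpiderSet T p q (w x)) × (∀ y → SpiderSet T p q y → ∃[ x ] w x ≡ y)

    P4Set-cases : ∀ {w} → InducesP4 H w → (∀ x → InImage ι (w x)) ⊎ SpiderQuad w
    P4Set-cases (a , b , c , d , path) with P4-cases path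
    ... | inj₂ (a∈ι , b∈ι , c∈ι , d∈ι) = inj₁ (InducedPathP4-covers {H = H} path (InImage ι) a∈ι b∈ι c∈ι d∈ι)
    ... | inj₁ (p , q , p≢i₀ , q≢i₀ , sp≡a , kq≡b , kp≡c , sq≡d) =
      inj₂ (p , q , p≢i₀ , q≢i₀ ,
            InducedPathP4-covers {H = H} path (SpiderSet T p q)
              (p , inj₁ refl , inj₁ sp≡a) (q , inj₂ refl , inj₂ kq≡b) (p , inj₁ refl , inj₂ kp≡c) (q , inj₂ refl , inj₁ sq≡d) ,
            λ { y (_ , inj₁ refl , inj₁ refl) → a , sym sp≡a
              ; y (_ , inj₁ refl , inj₂ refl) → c , sym kp≡c
              ; y (_ , inj₂ refl , inj₁ refl) → d , sym sq≡d
              ; y (_ , inj₂ refl , inj₂ refl) → b , sym kq≡b })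

    SpiderSet-∉ι : ∀ {p q y} → p ≢ i₀ → q ≢ i₀ → SpiderSet T p q y → ¬ InImage ι y
    SpiderSet-∉ι p≢i₀ _ (t , inj₁ refl , inj₁ sₜ≡y) = S′∉ι (t , p≢i₀ , sₜ≡y)
    SpiderSet-∉ι p≢i₀ _ (t , inj₁ refl , inj₂ kₜ≡y) = K′∉ι (t , p≢i₀ , kₜ≡y)
    SpiderSet-∉ι _ q≢i₀ (t , inj₂ refl , inj₁ sₜ≡y) = S′∉ι (t , q≢i₀ , sₜ≡y)
    SpiderSet-∉ι _ q≢i₀ (t , inj₂ refl , inj₂ kₜ≡y) = K′∉ι (t , q≢i₀ , kₜ≡y)

    module _ (v : Fin 5 → Fin n) (v-inj : Injective _≡_ _≡_ v) where

      omitted-covers : ∀ i l → l ≢ i → ∃[ x ] v (punchIn i x) ≡ v l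
      omitted-covers i l l≢i = punchOut (l≢i ∘ sym) , cong v (punchIn-punchOut (l≢i ∘ sym))

      omitted-excludes : ∀ i x → v (punchIn i x) ≢ v i
      omitted-excludes i x = punchInᵢ≢i i x ∘ v-inj

      inner-spider-impossible : ∀ {i j} → (∀ x → InImage ι (v (punchIn i x))) → ¬ SpiderQuad (v ∘ punchIn j)
      inner-spider-impossible {i} {j} inner (p , q , p≢i₀ , q≢i₀ , members , _)
        with fresh-index (s≤s (s≤s (s≤s z≤n))) i j
      ... | l , l≢i , l≢j with omitted-covers i l l≢i | omitted-covers j l l≢j
      ...   | x , eᵢ | x′ , eⱼ =
        SpiderSet-∉ι p≢i₀ q≢i₀ (subst (SpiderSet T p q) eⱼ (members x′)) (subst (InImage ι) eᵢ (inner x))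

      -- v i lies in the second 4-set only; its partner lies in both, and spider sets
      -- are closed under partners.
      spider-spider-impossible : ∀ {i j} → i ≢ j → SpiderQuad (v ∘ punchIn i) → ¬ SpiderQuad (v ∘ punchIn j)
      spider-spider-impossible {i} {j} i≢j (p₁ , q₁ , _ , _ , members₁ , complete₁) (p₂ , q₂ , _ , _ , members₂ , complete₂)
        with omitted-covers j i i≢j
      ... | x₀ , e₀ with SpiderSet-partner T (subst (SpiderSet T p₂ q₂) e₀ (members₂ x₀))
      ...   | y′ , y′≢vᵢ , y′∈₂ , back with complete₂ y′ y′∈₂
      ...     | x′ , e′ with omitted-covers i (punchIn j x′) (λ l≡i → y′≢vᵢ (trans (sym e′) (cong v l≡i)))
      ...       | x″ , e″ with complete₁ (v i) (back (subst (SpiderSet T p₁ q₁) (trans e″ e′) (members₁ x″)))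
      ...         | x‴ , e‴ = omitted-excludes i x‴ e‴

      both-inner⇒≡ : ∀ {i j} → P4Sparse H′ → i ≢ j → (∀ x → InImage ι (v (punchIn i x))) → (∀ x → InImage ι (v (punchIn j x))) →
        InducesP4 H (v ∘ punchIn i) → InducesP4 H (v ∘ punchIn j) → i ≡ j
      both-inner⇒≡ {i} {j} sparse′ i≢j innerᵢ innerⱼ Pᵢ Pⱼ = sparse′ v′ v′-inj i j (pull-back Pᵢ) (pull-back Pⱼ)
        where
        all-inner : ∀ l → InImage ι (v l)
        all-inner l with l ≟ i
        ... | yes refl = let (x , e) = omitted-covers j l i≢j in subst (InImage ι) e (innerⱼ x)
        ... | no l≢i   = let (x , e) = omitted-covers i l l≢i in subst (InImage ι) e (innerᵢ x)
        v′ : Fin 5 → Fin m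
        v′ l = proj₁ (all-inner l)
        ιv′ : ∀ l → ι (v′ l) ≡ v l
        ιv′ l = proj₂ (all-inner l)
        v′-inj : Injective _≡_ _≡_ v′
        v′-inj {a} {b} e = v-inj (trans (sym (ιv′ a)) (trans (cong ι e) (ιv′ b)))
        pull-back : ∀ {t} → InducesP4 H (v ∘ punchIn t) → InducesP4 H′ (v′ ∘ punchIn t)
        pull-back = InducesP4-transfer {A = H} {B = H′}
          (λ x y → trans (sym (completion-image _ _)) (cong₂ (adj H) (ιv′ _) (ιv′ _)))
          (λ e → trans (sym (ιv′ _)) (trans (cong ι e) (ιv′ _)))

    completion-sparse : P4Sparse H′ → P4Sparse H
    completion-sparse sparse′ v v-inj i j Pᵢ Pⱼ with i ≟ j
    ... | yes i≡j = i≡j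
    ... | no i≢j with P4Set-cases Pᵢ | P4Set-cases Pⱼ
    ...   | inj₁ innerᵢ | inj₁ innerⱼ = both-inner⇒≡ v v-inj sparse′ i≢j innerᵢ innerⱼ Pᵢ Pⱼ
    ...   | inj₁ innerᵢ | inj₂ spiderⱼ = ⊥-elim (inner-spider-impossible v v-inj innerᵢ spiderⱼ)
    ...   | inj₂ spiderᵢ | inj₁ innerⱼ = ⊥-elim (inner-spider-impossible v v-inj innerⱼ spiderᵢ)
    ...   | inj₂ spiderᵢ | inj₂ spiderⱼ = ⊥-elim (spider-spider-impossible v v-inj i≢j spiderᵢ spiderⱼ)

  module _ (k≥3 : 3 ≤ k) (r : Fin n) (r∈R : InR r) (H : Graph n) (sol : IsSolution G s r H) where

    FillOutsideImage : Set
    FillOutsideImage = ∃[ p ] ∃[ q ] ¬ InImage ι p × p ≢ q × Edge H p q × NonEdge G p q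

    private
      module TwoLegs {i₁ i₂} (i₁≢i₀ : i₁ ≢ i₀) (i₂≢i₀ : i₂ ≢ i₀) (i₁≢i₂ : i₁ ≢ i₂) where

        s₁ s₂ : Fin n
        s₁ = sv i₁
        s₂ = sv i₂
        s₁∉ι : ¬ InImage ι s₁
        s₁∉ι = S′∉ι (i₁ , i₁≢i₀ , refl)
        s₂∉ι : ¬ InImage ι s₂
        s₂∉ι = S′∉ι (i₂ , i₂≢i₀ , refl)
        s₁≢s₂ : s₁ ≢ s₂
        s₁≢s₂ = i₁≢i₂ ∘ sv-inj
        s₁≢u : s₁ ≢ u
        s₁≢u = disjointSK i₁ i₀
        s₂≢u : s₂ ≢ u
        s₂≢u = disjointSK i₂ i₀
        s₁≢r : s₁ ≢ r
        s₁≢r e = proj₁ r∈R (i₁ , e)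
        s₂≢r : s₂ ≢ r
        s₂≢r e = proj₁ r∈R (i₂ , e)
        s₁≢s : s₁ ≢ s
        s₁≢s = i₁≢i₀ ∘ sv-inj
        s₂≢s : s₂ ≢ s
        s₂≢s = i₂≢i₀ ∘ sv-inj
        u≢r : u ≢ r
        u≢r e = proj₂ r∈R (i₀ , e)
        r≢s : r ≢ s
        r≢s e = proj₁ r∈R (i₀ , sym e)
        v : Fin 5 → Fin n
        v = lookup (s₁ ∷ s₂ ∷ u ∷ r ∷ s ∷ [])
        v-inj : Injective _≡_ _≡_ v
        v-inj {a} {b} = lookup-injective
          ((s₁≢s₂ ∷ s₁≢u ∷ s₁≢r ∷ s₁≢s ∷ []) ∷ (s₂≢u ∷ s₂≢r ∷ s₂≢s ∷ []) ∷ (u≢r ∷ u≢s ∷ []) ∷ (r≢s ∷ []) ∷ [] ∷ []) a b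
        G⊆H : ∀ x y → Edge G x y → Edge H x y
        G⊆H = proj₁ (proj₂ sol)
        Gus : NonEdge G u s
        Gus = adj-swap G (partner-nonadjacent T i₀)
        s₁u : Edge H s₁ u
        s₁u = G⊆H s₁ u (proj₂ (S-K-thick i₁ i₀) i₁≢i₀)
        s₂u : Edge H s₂ u
        s₂u = G⊆H s₂ u (proj₂ (S-K-thick i₂ i₀) i₂≢i₀)
        ur : Edge H u r
        ur = G⊆H u r (adj-swap G (R-K-complete r r∈R i₀))
        rs : Edge H r s
        rs = adj-swap H (proj₂ (proj₂ sol))

        fill-near-legs : FillOutsideImage
        fill-near-legs
          with adj H u s in us | adj H s₁ s₂ in s₁s₂ | adj H s₁ r in s₁r | adj H s₂ r in s₂r
             | adj H s₁ s in s₁s | adj H s₂ s in s₂s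
        ... | true  | _     | _     | _     | _     | _     = u , s , K∉ι i₀ , u≢s , us , Gus
        ... | false | true  | _     | _     | _     | _     = s₁ , s₂ , s₁∉ι , s₁≢s₂ , s₁s₂ , S-independent i₁ i₂
        ... | false | false | true  | _     | _     | _     = s₁ , r , s₁∉ι , s₁≢r , s₁r , adj-swap G (R-S-none r r∈R i₁)
        ... | false | false | false | true  | _     | _     = s₂ , r , s₂∉ι , s₂≢r , s₂r , adj-swap G (R-S-none r r∈R i₂)
        ... | false | false | false | false | true  | _     = s₁ , s , s₁∉ι , s₁≢s , s₁s , S-independent i₁ i₀
        ... | false | false | false | false | false | true  = s₂ , s , s₂∉ι , s₂≢s , s₂s , S-independent i₂ i₀
        -- Otherwise s₁ u r s and s₂ u r s are two P4s on the five vertices of v.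
        ... | false | false | false | false | false | false =
          contradiction (proj₁ sol v v-inj 1F 0F P₁ P₂) λ ()
          where
          P₁ : InducesP4 H (v ∘ punchIn 1F)
          P₁ = 0F , 1F , 2F , 3F , (s₁≢u , s₁≢r , s₁≢s , u≢r , u≢s , r≢s) , (s₁u , ur , rs) , (s₁r , s₁s , us)
          P₂ : InducesP4 H (v ∘ punchIn 0F)
          P₂ = 0F , 1F , 2F , 3F , (s₂≢u , s₂≢r , s₂≢s , u≢r , u≢s , r≢s) , (s₂u , ur , rs) , (s₂r , s₂s , us)

    fill-outside-image : FillOutsideImage
    fill-outside-image with fresh-index k≥3 i₀ i₀
    ... | i₁ , i₁≢i₀ , _ with fresh-index k≥3 i₀ i₁
    ...   | i₂ , i₂≢i₀ , i₂≢i₁ = TwoLegs.fill-near-legs i₁≢i₀ i₂≢i₀ (i₂≢i₁ ∘ sym)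

    fillCount-induced-< : fillCount (induced G ι) (induced H ι) < fillCount G H
    fillCount-induced-< with fill-outside-image
    ... | p , q , p∉ι , p≢q , pq , Gpq = *-cancelˡ-≤ 2 (begin
      2 * suc (fillCount (induced G ι) (induced H ι))   ≡⟨ *-suc 2 _ ⟩
      2 + 2 * fillCount (induced G ι) (induced H ι)     ≡⟨ cong (2 +_) (fillSum≡2*fillCount (induced G ι) (induced H ι)) ⟨
      2 + fillSum (induced G ι) (induced H ι)           ≤⟨ 2+fillSum-induced≤fillSum ι-inj G H p∉ι p≢q pq Gpq ⟩
      fillSum G H                                       ≡⟨ fillSum≡2*fillCount G H ⟩
      2 * fillCount G H                                 ∎)
      where open ≤-Reasoning

lemma16 : ∀ {n} (G : Graph n) (T : ThickSpider G) → 3 ≤ ThickSpider.k T →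
    ∀ (i₀ : Fin (ThickSpider.k T)) (r : Fin n) → ThickSpider.InR T r →
    NonEdge G (ThickSpider.sv T i₀) r →
    ∀ (m : ℕ) (ι : Fin m → Fin n) → Injective _≡_ _≡_ ι →
    (∀ x → (∃[ j ] ι j ≡ x) ⇔ (x ≡ ThickSpider.sv T i₀ ⊎ ThickSpider.InR T x)) →
    ∀ (js jr : Fin m) → ι js ≡ ThickSpider.sv T i₀ → ι jr ≡ r →
    ∀ (μ : ℕ) →
    (∃[ H' ] (IsOptimalSolution (induced G ι) js jr H' × fillCount (induced G ι) H' ≡ μ)) →
    ∃[ H ] (IsOptimalSolution G (ThickSpider.sv T i₀) r H × fillCount G H ≡ suc μ)
-- The hypothesis that s r is a non-edge is implied by R-S-none, hence unused.
lemma16 G T k≥3 i₀ r r∈R _ m ι ι-inj image-iff js jr ιjs≡s ιjr≡r _ (H′ , (H′-sol , H′-min) , refl) =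
  completion H′ , (H-sol , H-min) , fillCount-completion H′
  where
  open Completion T i₀ ι-inj image-iff

  H-sol : IsSolution G s r (completion H′)
  H-sol = completion-sparse H′ (proj₁ H′-sol) , completion-⊇ H′ (proj₁ (proj₂ H′-sol)) ,
          subst₂ (Edge (completion H′)) ιjs≡s ιjr≡r (trans (completion-image H′ js jr) (proj₂ (proj₂ H′-sol)))

  H-min : ∀ H″ → IsSolution G s r H″ → fillCount G (completion H′) ≤ fillCount G H″
  H-min H″ sol = begin
    fillCount G (completion H′)                         ≡⟨ fillCount-completion H′ ⟩
    suc (fillCount (induced G ι) H′)                    ≤⟨ s≤s (H′-min (induced H″ ι) (IsSolution-induced {G = G} {H = H″} ι-inj ιjs≡s ιjr≡r sol)) ⟩
    suc (fillCount (induced G ι) (induced H″ ι))        ≤⟨ fillCount-induced-< k≥3 r r∈R H″ sol ⟩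
    fillCount G H″                                      ∎
    where open ≤-Reasoning
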